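{- Let $(P,\le)$ be a poset and $M,N\in P^\#$. Then $N<<M$ if and only if $N\preceq M$ and for every $p\in M$ there exists $q\in N$ with $q\le p$.
   Context: A finite multiset of $P$ is a map $M\colon B\to\omega\setminus\{0\}$ with $B$ a finite subset of $P$; $M(b)$ is the number of occurrences of $b$ in $M$, and an element of $M$ means a specific occurrence. $P^\#$ is the set of finite multisets of $P$. A map $f\colon M\to N$ between finite multisets assigns to each occurrence in $M$ exactly one occurrence in $N$; it is injective if distinct occurrences go to distinct occurrences, and surjective if every occurrence of $N$ is hit. Multiset embeddability: $N\preceq M$ iff there is an injective map $f\colon N\to M$ with $p\le f(p)$ for all $p\in N$. Multiset projectivity: $N<<M$ iff there is a surjective map $f\colon M\to N$ with $f(p)\le p$ for all $p\in M$. -}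

module Defs where

open import Level using (_⊔_)
open import Data.List using (List; length; lookup)
open import Data.Fin using (Fin)
open import Data.Product using (Σ; ∃; _×_)
open import Relation.Binary.PropositionalEquality using (_≡_)
open import Relation.Binary.Bundles using (Poset)

-- A finite multiset of P is represented by a list of elements of P
-- (the order of the list is irrelevant to all notions below).
-- The occurrences (elements) of a multiset xs are its positions Fin (length xs);
-- the value of occurrence i is  lookup xs i.

module _ {c ℓ₁ ℓ₂} (P : Poset c ℓ₁ ℓ₂) where
  open Poset P

  Multiset : Set c
  Multiset = List Carrier

  Occ : Multiset → Set
  Occ xs = Fin (length xs)

  record _⪯_ (N M : Multiset) : Set ℓ₂ where
    field
      f        : Occ N → Occ M
      inj      : ∀ i j → f i ≡ f j → i ≡ j
      increase : ∀ i → lookup N i ≤ lookup M (f i)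

  record _≪_ (N M : Multiset) : Set ℓ₂ where
    field
      f        : Occ M → Occ N
      surj     : ∀ j → ∃ λ i → f i ≡ j
      decrease : ∀ i → lookup N (f i) ≤ lookup M i

{-# OPTIONS --safe #-}
-- If f : M → N is surjective with f(p) ≤ p, any section s of f is injective and
-- satisfies q = f(s q) ≤ s q, and every p ∈ M lies above f(p) ∈ N.
-- Conversely, given an embedding g : N → M, invert g on its image and send every
-- other occurrence of M to some occurrence of N below it; the resulting map is
-- surjective because it is a left inverse of g.
module Submission where

open import Defs
open import Data.Empty using (⊥-elim)
open import Data.Fin using (Fin)
open import Data.Fin.Properties using (any?; _≟_)
open import Data.List using (lookup)
open import Data.Product using (∃; _×_; _,_; proj₁; proj₂; uncurry)
open import Function using (_∘_)
open import Function.Bundles using (_⇔_; mk⇔)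
open import Function.Consequences.Propositional using (inverseʳ⇒injective; strictlyInverseʳ⇒inverseʳ)
open import Function.Definitions using (Injective; StrictlyInverseʳ)
open import Relation.Binary.Bundles using (Poset)
open import Relation.Binary.Definitions using (DecidableEquality)
open import Relation.Binary.PropositionalEquality using (_≡_; refl; subst)
open import Relation.Nullary using (yes; no)

module _ {b n} {B : Set b} (_≟ᴮ_ : DecidableEquality B)
         (g : Fin n → B) (fallback : B → Fin n) where

  retraction : B → Fin n
  retraction p with any? (λ q → g q ≟ᴮ p)
  ... | yes (q , _) = q
  ... | no _        = fallback p

  retraction-respects : ∀ {r} (R : Fin n → B → Set r) →
                        (∀ q → R q (g q)) → (∀ p → R (fallback p) p) →
                        ∀ p → R (retraction p) p
  retraction-respects R onImage offImage p with any? (λ q → g q ≟ᴮ p)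
  ... | yes (q , refl) = onImage q
  ... | no _           = offImage p

  retraction-strictlyInverseʳ : Injective _≡_ _≡_ g → StrictlyInverseʳ _≡_ g retraction
  retraction-strictlyInverseʳ inj j with any? (λ q → g q ≟ᴮ g j)
  ... | yes (q , gq≡gj) = inj gq≡gj
  ... | no ∄q           = ⊥-elim (∄q (j , refl))

module _ {c ℓ₁ ℓ₂} (P : Poset c ℓ₁ ℓ₂) where
  open Poset P using (_≤_)

  _⊆↑_ : Multiset P → Multiset P → Set ℓ₂
  M ⊆↑ N = ∀ (p : Occ P M) → ∃ λ (q : Occ P N) → lookup N q ≤ lookup M p

  ≪⇒⊆↑ : ∀ {M N} → _≪_ P N M → M ⊆↑ N
  ≪⇒⊆↑ N≪M p = f p , decrease p
    where open _≪_ N≪M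

  ≪⇒⪯ : ∀ {M N} → _≪_ P N M → _⪯_ P N M
  ≪⇒⪯ {M} {N} N≪M = record
    { f        = section
    ; inj      = λ i j → section-injective
    ; increase = λ q → subst (λ q′ → lookup N q′ ≤ lookup M (section q))
                             (f∘section q) (decrease (section q))
    }
    where
    open _≪_ N≪M
    section : Occ P N → Occ P M
    section = proj₁ ∘ surj
    f∘section : StrictlyInverseʳ _≡_ section f
    f∘section = proj₂ ∘ surj
    section-injective : Injective _≡_ _≡_ section
    section-injective =
      inverseʳ⇒injective {f⁻¹ = f} section (strictlyInverseʳ⇒inverseʳ {f⁻¹ = f} section f∘section)

  ⪯∧⊆↑⇒≪ : ∀ {M N} → _⪯_ P N M → M ⊆↑ N → _≪_ P N M
  ⪯∧⊆↑⇒≪ {M} {N} N⪯M M⊆↑N = record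
    { f        = retraction _≟_ f (proj₁ ∘ M⊆↑N)
    ; surj     = λ q → f q , retraction-strictlyInverseʳ _≟_ f (proj₁ ∘ M⊆↑N) (λ {i} {j} → inj i j) q
    ; decrease = retraction-respects _≟_ f (proj₁ ∘ M⊆↑N)
                   (λ q p → lookup N q ≤ lookup M p) increase (proj₂ ∘ M⊆↑N)
    }
    where open _⪯_ N⪯M

lemma2p11 : ∀ {c ℓ₁ ℓ₂} (P : Poset c ℓ₁ ℓ₂) (M N : Multiset P) →
    (_≪_ P N M) ⇔ ((_⪯_ P N M) × (∀ (p : Occ P M) → ∃ λ (q : Occ P N) → Poset._≤_ P (lookup N q) (lookup M p)))
lemma2p11 P M N = mk⇔ (λ N≪M → ≪⇒⪯ P N≪M , ≪⇒⊆↑ P N≪M) (uncurry (⪯∧⊆↑⇒≪ P))
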